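{- (Pascal's rule) For all $n\in\mathbb N$ and all $k\in\mathbb Z$ with $k\ge-1$, $$\left[{n\atop k}\right]+\left[{n\atop k+2}\right]=\left[{n+2\atop k+2}\right].$$
   Context: $\mathbb N=\{0,1,2,\dots\}$. For $n,k\in\mathbb Z$ define the $1/2$-binomial coefficient $$\left[{n\atop k}\right]:=\frac{\Gamma(\frac n2+1)}{\Gamma(\frac k2+1)\,\Gamma(\frac{n-k}2+1)},$$ where $\Gamma$ is Euler's Gamma function, with the convention $1/\Gamma(z)=0$ for $z\in\mathbb Z_{\le0}$; in particular the coefficient is $0$ whenever $(n-k)/2\in\mathbb Z_{\le-1}$ or $k/2\in\mathbb Z_{\le -1}$. -}

module Defs where

-- Exact model of the values of Euler's Gamma function at half-integers.
-- Every value Γ(m/2) (m ∈ ℤ, not a pole) is q · (√π)^e with q ∈ ℚ, e ∈ ℤ,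
-- and likewise 1/Γ(m/2) (which is 0 at the poles).  Since π is
-- transcendental, distinct powers of √π are ℚ-linearly independent, so a
-- real number of the form Σ_e q_e (√π)^e is faithfully represented by its
-- coefficient function e ↦ q_e.

open import Data.Nat as ℕ using (ℕ; zero; suc)
open import Data.Integer as ℤ using (ℤ; +_; -[1+_])
open import Data.Rational as ℚ using (ℚ; 0ℚ; 1ℚ)
open import Data.Bool using (if_then_else_)
open import Relation.Nullary using (does)
open import Relation.Binary.PropositionalEquality using (_≡_)

-- q · (√π)^e
record Mono : Set where
  constructor mono
  field
    coeff : ℚ
    expo  : ℤ

open Mono public

_⊗_ : Mono → Mono → Mono
mono a e ⊗ mono b f = mono (a ℚ.* b) (e ℤ.+ f)

scale : ℚ → Mono → Mono
scale q (mono a e) = mono (q ℚ.* a) e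

Val : Set
Val = ℤ → ℚ

⟦_⟧ : Mono → Val
⟦ mono a e ⟧ f = if does (e ℤ.≟ f) then a else 0ℚ

_⊕_ : Val → Val → Val
(x ⊕ y) f = x f ℚ.+ y f

_≈_ : Val → Val → Set
x ≈ y = ∀ f → x f ≡ y f

-- gam n = Γ(n/2 + 1) for n ∈ ℕ
--   Γ(1) = 1, Γ(3/2) = √π/2, Γ(z+1) = z Γ(z)
gam : ℕ → Mono
gam zero = mono 1ℚ (+ 0)
gam (suc zero) = mono (+ 1 ℚ./ 2) (+ 1)
gam (suc (suc n)) = scale (+ (suc (suc n)) ℚ./ 2) (gam n)

-- rgPos n = 1/Γ((n+1)/2)
--   1/Γ(1/2) = (√π)^(-1), 1/Γ(1) = 1, 1/Γ(z+1) = (1/z)·(1/Γ(z))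
rgPos : ℕ → Mono
rgPos zero = mono 1ℚ (-[1+ 0 ])
rgPos (suc zero) = mono 1ℚ (+ 0)
rgPos (suc (suc n)) = scale (+ 2 ℚ./ suc n) (rgPos n)

-- rgNeg n = 1/Γ(-n/2)  (= 0 at the poles -n/2 ∈ ℤ≤0)
--   1/Γ(0) = 0, 1/Γ(z) = z · 1/Γ(z+1)
rgNeg : ℕ → Mono
rgNeg zero = mono 0ℚ (+ 0)
rgNeg (suc zero) = scale (ℤ.- (+ 1) ℚ./ 2) (rgPos zero)
rgNeg (suc (suc n)) = scale (ℤ.- (+ suc (suc n)) ℚ./ 2) (rgNeg n)

-- rGamma m = 1/Γ(m/2) for m ∈ ℤ, with 1/Γ(z) = 0 for z ∈ ℤ≤0
rGamma : ℤ → Mono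
rGamma (+ zero) = rgNeg zero
rGamma (+ suc n) = rgPos n
rGamma -[1+ n ] = rgNeg (suc n)

-- the 1/2-binomial coefficient [n k] = Γ(n/2+1) / (Γ(k/2+1) Γ((n-k)/2+1))
halfBinom : ℕ → ℤ → Mono
halfBinom n k = gam n ⊗ (rGamma (k ℤ.+ + 2) ⊗ rGamma ((+ n ℤ.- k) ℤ.+ + 2))

-- Write Q for Γ(n/2+1) / (Γ(k/2+2) Γ((n-k)/2+1)).  The functional equation
-- 1/Γ(z) = z · 1/Γ(z+1) (valid at the poles too) gives [n k] = ((k+2)/2) Q and
-- [n k+2] = ((n-k)/2) Q, while Γ(n/2+2) = ((n+2)/2) Γ(n/2+1) gives
-- [n+2 k+2] = ((n+2)/2) Q; the weights add up since (k+2) + (n-k) = n+2.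
module Submission where

open import Defs
open import Data.Nat as ℕ using (ℕ; zero; suc) renaming (_+_ to _+ℕ_)
import Data.Nat.Properties as ℕ
open import Data.Integer as ℤ using (ℤ; +_; -[1+_]; _≤_; _+_)
open import Data.Integer.Tactic.RingSolver using (solve-∀)
open import Data.Rational as ℚ using (ℚ; 1ℚ; fromℚᵘ)
import Data.Rational.Properties as ℚ
import Data.Rational.Unnormalised as ℚᵘ
import Data.Rational.Unnormalised.Properties as ℚᵘ
open import Data.Bool using (true; false)
open import Relation.Nullary using (does)
open import Relation.Binary.PropositionalEquality
open ≡-Reasoning

fromℚᵘ-homo-+ : ∀ p q → fromℚᵘ (p ℚᵘ.+ q) ≡ fromℚᵘ p ℚ.+ fromℚᵘ q
fromℚᵘ-homo-+ p q = ℚ.toℚᵘ-injective (ℚᵘ.≃-trans (ℚ.toℚᵘ-fromℚᵘ (p ℚᵘ.+ q))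
  (ℚᵘ.≃-sym (ℚᵘ.≃-trans (ℚ.toℚᵘ-homo-+ (fromℚᵘ p) (fromℚᵘ q))
    (ℚᵘ.+-cong (ℚ.toℚᵘ-fromℚᵘ p) (ℚ.toℚᵘ-fromℚᵘ q)))))

fromℚᵘ-homo-* : ∀ p q → fromℚᵘ (p ℚᵘ.* q) ≡ fromℚᵘ p ℚ.* fromℚᵘ q
fromℚᵘ-homo-* p q = ℚ.toℚᵘ-injective (ℚᵘ.≃-trans (ℚ.toℚᵘ-fromℚᵘ (p ℚᵘ.* q))
  (ℚᵘ.≃-sym (ℚᵘ.≃-trans (ℚ.toℚᵘ-homo-* (fromℚᵘ p) (fromℚᵘ q))
    (ℚᵘ.*-cong (ℚ.toℚᵘ-fromℚᵘ p) (ℚ.toℚᵘ-fromℚᵘ q)))))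

half : ℤ → ℚ
half m = m ℚ./ 2

half-+ : ∀ a b → half a ℚ.+ half b ≡ half (a + b)
half-+ a b = begin
  half a ℚ.+ half b                            ≡⟨ fromℚᵘ-homo-+ (ℚᵘ.mkℚᵘ a 1) (ℚᵘ.mkℚᵘ b 1) ⟨
  fromℚᵘ (ℚᵘ.mkℚᵘ a 1 ℚᵘ.+ ℚᵘ.mkℚᵘ b 1)       ≡⟨ ℚ.fromℚᵘ-cong {ℚᵘ.mkℚᵘ a 1 ℚᵘ.+ ℚᵘ.mkℚᵘ b 1} {ℚᵘ.mkℚᵘ (a + b) 1} (ℚᵘ.*≡* (cross a b)) ⟩
  half (a + b)                                 ∎
  where
  cross : ∀ a b → (a ℤ.* + 2 + b ℤ.* + 2) ℤ.* + 2 ≡ (a + b) ℤ.* (+ 2 ℤ.* + 2)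
  cross = solve-∀

half-*-2/ : ∀ n → half (+ suc n) ℚ.* (+ 2 ℚ./ suc n) ≡ 1ℚ
half-*-2/ n = begin
  half (+ suc n) ℚ.* (+ 2 ℚ./ suc n)             ≡⟨ fromℚᵘ-homo-* (ℚᵘ.mkℚᵘ (+ suc n) 1) (ℚᵘ.mkℚᵘ (+ 2) n) ⟨
  fromℚᵘ (ℚᵘ.mkℚᵘ (+ suc n) 1 ℚᵘ.* ℚᵘ.mkℚᵘ (+ 2) n) ≡⟨ ℚ.fromℚᵘ-cong {ℚᵘ.mkℚᵘ (+ suc n) 1 ℚᵘ.* ℚᵘ.mkℚᵘ (+ 2) n} {ℚᵘ.mkℚᵘ (+ 1) 0} (ℚᵘ.*≡* (cross (+ suc n))) ⟩
  1ℚ                                             ∎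
  where
  cross : ∀ m → (m ℤ.* + 2) ℤ.* + 1 ≡ + 1 ℤ.* (+ 2 ℤ.* m)
  cross = solve-∀

scale-identity : ∀ x → scale 1ℚ x ≡ x
scale-identity (mono a e) = cong (λ c → mono c e) (ℚ.*-identityˡ a)

scale-scale : ∀ p q x → scale p (scale q x) ≡ scale (p ℚ.* q) x
scale-scale p q (mono a e) = cong (λ c → mono c e) (sym (ℚ.*-assoc p q a))

scale-⊗ : ∀ q x y → scale q x ⊗ y ≡ scale q (x ⊗ y)
scale-⊗ q (mono a e) (mono b f) = cong (λ c → mono c (e ℤ.+ f)) (ℚ.*-assoc q a b)

⊗-scale : ∀ q x y → x ⊗ scale q y ≡ scale q (x ⊗ y)
⊗-scale q (mono a e) (mono b f) = cong (λ c → mono c (e ℤ.+ f)) (begin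
  a ℚ.* (q ℚ.* b) ≡⟨ ℚ.*-assoc a q b ⟨
  (a ℚ.* q) ℚ.* b ≡⟨ cong (ℚ._* b) (ℚ.*-comm a q) ⟩
  (q ℚ.* a) ℚ.* b ≡⟨ ℚ.*-assoc q a b ⟩
  q ℚ.* (a ℚ.* b) ∎)

⟦⟧-scale-+ : ∀ p q x → (⟦ scale p x ⟧ ⊕ ⟦ scale q x ⟧) ≈ ⟦ scale (p ℚ.+ q) x ⟧
⟦⟧-scale-+ p q (mono a e) f with does (e ℤ.≟ f)
... | true  = sym (ℚ.*-distribʳ-+ a p q)
... | false = ℚ.+-identityˡ _

gam-step : ∀ n → gam (n +ℕ 2) ≡ scale (half (+ (n +ℕ 2))) (gam n)
gam-step n rewrite ℕ.+-comm n 2 = refl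

rgPos-step : ∀ n → rgPos (n +ℕ 2) ≡ scale (+ 2 ℚ./ suc n) (rgPos n)
rgPos-step n rewrite ℕ.+-comm n 2 = refl

-- 1/Γ(m/2) = (m/2) · 1/Γ(m/2 + 1), including at the poles, where both sides vanish.
rGamma-step : ∀ m → rGamma m ≡ scale (half m) (rGamma (m + + 2))
rGamma-step (+ zero)            = refl
rGamma-step (+ suc n)           = begin
  rgPos n                                           ≡⟨ scale-identity (rgPos n) ⟨
  scale 1ℚ (rgPos n)                                ≡⟨ cong (λ c → scale c (rgPos n)) (half-*-2/ n) ⟨
  scale (half (+ suc n) ℚ.* (+ 2 ℚ./ suc n)) (rgPos n) ≡⟨ scale-scale (half (+ suc n)) (+ 2 ℚ./ suc n) (rgPos n) ⟨
  scale (half (+ suc n)) (scale (+ 2 ℚ./ suc n) (rgPos n)) ≡⟨ cong (scale (half (+ suc n))) (rgPos-step n) ⟨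
  scale (half (+ suc n)) (rgPos (n +ℕ 2))           ∎
rGamma-step -[1+ zero ]         = refl
rGamma-step -[1+ suc zero ]     = refl
rGamma-step -[1+ suc (suc m) ]  = refl

gammaQuotient : ℕ → ℤ → ℤ → Mono
gammaQuotient n a b = gam n ⊗ (rGamma a ⊗ rGamma b)

gammaQuotient-stepˡ : ∀ n a b → gammaQuotient n a b ≡ scale (half a) (gammaQuotient n (a + + 2) b)
gammaQuotient-stepˡ n a b = begin
  gam n ⊗ (rGamma a ⊗ rGamma b)                                    ≡⟨ cong (λ x → gam n ⊗ (x ⊗ rGamma b)) (rGamma-step a) ⟩
  gam n ⊗ (scale (half a) (rGamma (a + + 2)) ⊗ rGamma b)           ≡⟨ cong (gam n ⊗_) (scale-⊗ (half a) (rGamma (a + + 2)) (rGamma b)) ⟩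
  gam n ⊗ scale (half a) (rGamma (a + + 2) ⊗ rGamma b)             ≡⟨ ⊗-scale (half a) (gam n) (rGamma (a + + 2) ⊗ rGamma b) ⟩
  scale (half a) (gam n ⊗ (rGamma (a + + 2) ⊗ rGamma b))           ∎

gammaQuotient-stepʳ : ∀ n a b → gammaQuotient n a b ≡ scale (half b) (gammaQuotient n a (b + + 2))
gammaQuotient-stepʳ n a b = begin
  gam n ⊗ (rGamma a ⊗ rGamma b)                                    ≡⟨ cong (λ x → gam n ⊗ (rGamma a ⊗ x)) (rGamma-step b) ⟩
  gam n ⊗ (rGamma a ⊗ scale (half b) (rGamma (b + + 2)))           ≡⟨ cong (gam n ⊗_) (⊗-scale (half b) (rGamma a) (rGamma (b + + 2))) ⟩
  gam n ⊗ scale (half b) (rGamma a ⊗ rGamma (b + + 2))             ≡⟨ ⊗-scale (half b) (gam n) (rGamma a ⊗ rGamma (b + + 2)) ⟩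
  scale (half b) (gam n ⊗ (rGamma a ⊗ rGamma (b + + 2)))           ∎

gammaQuotient-numerator-step : ∀ n a b → gammaQuotient (n +ℕ 2) a b ≡ scale (half (+ (n +ℕ 2))) (gammaQuotient n a b)
gammaQuotient-numerator-step n a b = begin
  gam (n +ℕ 2) ⊗ (rGamma a ⊗ rGamma b)                              ≡⟨ cong (_⊗ (rGamma a ⊗ rGamma b)) (gam-step n) ⟩
  scale (half (+ (n +ℕ 2))) (gam n) ⊗ (rGamma a ⊗ rGamma b)         ≡⟨ scale-⊗ (half (+ (n +ℕ 2))) (gam n) (rGamma a ⊗ rGamma b) ⟩
  scale (half (+ (n +ℕ 2))) (gam n ⊗ (rGamma a ⊗ rGamma b))         ∎

mainTheorem4 : (n : ℕ) (k : ℤ) → -[1+ 0 ] ≤ k →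
    (⟦ halfBinom n k ⟧ ⊕ ⟦ halfBinom n (k + + 2) ⟧) ≈ ⟦ halfBinom (n +ℕ 2) (k + + 2) ⟧
mainTheorem4 n k _ f = begin
  ⟦ halfBinom n k ⟧ f ℚ.+ ⟦ halfBinom n (k + + 2) ⟧ f ≡⟨ cong₂ (λ x y → ⟦ x ⟧ f ℚ.+ ⟦ y ⟧ f) lower upper ⟩
  ⟦ scale (half a) Q ⟧ f ℚ.+ ⟦ scale (half b) Q ⟧ f  ≡⟨ ⟦⟧-scale-+ (half a) (half b) Q f ⟩
  ⟦ scale (half a ℚ.+ half b) Q ⟧ f                  ≡⟨ cong (λ c → ⟦ scale c Q ⟧ f) weights ⟩
  ⟦ scale (half (+ (n +ℕ 2))) Q ⟧ f                  ≡⟨ cong (λ x → ⟦ x ⟧ f) pascal ⟨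
  ⟦ halfBinom (n +ℕ 2) (k + + 2) ⟧ f                 ∎
  where
  a b : ℤ
  a = k + + 2
  b = (+ n ℤ.- a) + + 2
  Q : Mono
  Q = gammaQuotient n (a + + 2) ((+ n ℤ.- k) + + 2)

  upperIndex : ∀ m j → ((m ℤ.- (j + + 2)) + + 2) + + 2 ≡ (m ℤ.- j) + + 2
  upperIndex = solve-∀
  shiftedIndex : ∀ m j → ((m + + 2) ℤ.- (j + + 2)) + + 2 ≡ (m ℤ.- j) + + 2
  shiftedIndex = solve-∀
  indexSum : ∀ m j → (j + + 2) + ((m ℤ.- (j + + 2)) + + 2) ≡ m + + 2
  indexSum = solve-∀

  lower : halfBinom n k ≡ scale (half a) Q
  lower = gammaQuotient-stepˡ n a ((+ n ℤ.- k) + + 2)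
  upper : halfBinom n (k + + 2) ≡ scale (half b) Q
  upper = trans (gammaQuotient-stepʳ n (a + + 2) b)
                (cong (λ c → scale (half b) (gammaQuotient n (a + + 2) c)) (upperIndex (+ n) k))
  pascal : halfBinom (n +ℕ 2) (k + + 2) ≡ scale (half (+ (n +ℕ 2))) Q
  pascal = trans (cong (gammaQuotient (n +ℕ 2) (a + + 2)) (shiftedIndex (+ n) k))
                 (gammaQuotient-numerator-step n (a + + 2) ((+ n ℤ.- k) + + 2))
  weights : half a ℚ.+ half b ≡ half (+ (n +ℕ 2))
  weights = trans (half-+ a b) (cong half (indexSum (+ n) k))
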